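{- For every positive integer $d$ there exists a finite poset of width $d$ whose natural twin-width is at least $d-1$.
   Context: The width of a poset is the maximum size of an antichain in it; write $a\sim_P b$ if $a\leq_P b$ or $b\leq_P a$. A red poset is a triple $(X,\leq_P,R)$ where $(X,\leq_P)$ is a finite poset and $R$ is a set of unordered pairs of incomparable elements ("red edges"); its red degree is the maximum degree of the graph $(X,R)$. A contraction of two distinct vertices $x_1,x_2$ into a new vertex $x$ produces the red poset $(X',\leq',R')$ with $X'=(X\setminus\{x_1,x_2\})\cup\{x\}$, where: for $a,b\in X\setminus\{x_1,x_2\}$, $a\leq' b$ iff $a\leq_P b$; $x\leq' x$; $a\leq' x$ iff $a\leq_P x_1$ and $a\leq_P x_2$; $x\leq' a$ iff $x_1\leq_P a$ and $x_2\leq_P a$; and $R'$ consists of the pairs of $R$ contained in $X'$, the pairs $\{a,x\}$ with $\{a,x_1\}\in R$ or $\{a,x_2\}\in R$, and the pairs $\{a,x\}$ with $a\not\sim' x$ and ($a\sim_P x_1$ or $a\sim_P x_2$). A poset $(X,\leq)$ has natural twin-width at most $d$ if the red poset $(X,\leq,\emptyset)$ can be reduced to a single vertex by a sequence of contractions such that the red degree is at most $d$ at every step; the natural twin-width is the least such $d$. -}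

module Defs where

open import Data.Nat using (ℕ; _≤_)
open import Data.Fin using (Fin)
open import Data.List using (List; length)
open import Data.List.Relation.Unary.All using (All)
open import Data.List.Relation.Unary.Unique.Propositional using (Unique)
open import Data.List.Relation.Unary.AllPairs using (AllPairs)
open import Data.Maybe using (Maybe; just; nothing)
open import Data.Product using (Σ; _×_; ∃)
open import Data.Sum using (_⊎_)
open import Data.Empty using (⊥)
open import Data.Unit using (⊤)
open import Relation.Nullary using (¬_)
open import Relation.Binary.PropositionalEquality using (_≡_; _≢_)
open import Relation.Binary.Structures using (IsPartialOrder)

record FinPoset : Set₁ where
  field
    size    : ℕ
    _≤P_    : Fin size → Fin size → Set
    isPO    : IsPartialOrder _≡_ _≤P_

open FinPoset public

Comparable : (P : FinPoset) → Fin (size P) → Fin (size P) → Set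
Comparable P a b = _≤P_ P a b ⊎ _≤P_ P b a

-- An antichain, given as a list of pairwise incomparable elements
-- (pairwise incomparability forces the elements to be distinct,
-- since the order is reflexive).
IsAntichain : (P : FinPoset) → List (Fin (size P)) → Set
IsAntichain P l = AllPairs (λ a b → ¬ Comparable P a b) l

HasWidth : FinPoset → ℕ → Set
HasWidth P w =
  (∃ λ l → IsAntichain P l × length l ≡ w) ×
  (∀ l → IsAntichain P l → length l ≤ w)

-- Red posets.  Red edges are an (unordered, i.e. symmetric) relation;
-- {a,b} ∈ R is represented by red a b (all constructions keep it symmetric).

record RedPoset : Set₁ where
  field
    V    : Set
    _≤R_ : V → V → Set
    red  : V → V → Set

open RedPoset public

RedDegreeAtMost : ℕ → RedPoset → Set
RedDegreeAtMost d Q =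
  ∀ (v : V Q) (l : List (V Q)) → Unique l → All (red Q v) l → length l ≤ d

-- Vertices of the contraction: X' = (X ∖ {x1,x2}) ∪ {x},
-- with `nothing` standing for the new vertex x.
ContrV : (Q : RedPoset) → V Q → V Q → Set
ContrV Q x1 x2 = Maybe (Σ (V Q) λ a → a ≢ x1 × a ≢ x2)

contract : (Q : RedPoset) → (x1 x2 : V Q) → RedPoset
contract Q x1 x2 = record { V = ContrV Q x1 x2 ; _≤R_ = le' ; red = red' }
  where
  le : V Q → V Q → Set
  le = _≤R_ Q
  sim : V Q → V Q → Set
  sim a b = le a b ⊎ le b a
  le' : ContrV Q x1 x2 → ContrV Q x1 x2 → Set
  le' (just (a Data.Product., _)) (just (b Data.Product., _)) = le a b
  le' (just (a Data.Product., _)) nothing = le a x1 × le a x2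
  le' nothing (just (a Data.Product., _)) = le x1 a × le x2 a
  le' nothing nothing = ⊤
  sim' : ContrV Q x1 x2 → ContrV Q x1 x2 → Set
  sim' u w = le' u w ⊎ le' w u
  newRed : Σ (V Q) (λ a → a ≢ x1 × a ≢ x2) → Set
  newRed (a Data.Product., p) =
    (red Q a x1 ⊎ red Q a x2) ⊎
    (¬ sim' (just (a Data.Product., p)) nothing × (sim a x1 ⊎ sim a x2))
  red' : ContrV Q x1 x2 → ContrV Q x1 x2 → Set
  red' (just (a Data.Product., _)) (just (b Data.Product., _)) = red Q a b
  red' (just a) nothing = newRed a
  red' nothing (just a) = newRed a
  red' nothing nothing = ⊥

data Reducible (d : ℕ) : RedPoset → Set₁ where
  done : ∀ {Q} (x : V Q) → (∀ y → y ≡ x) → Reducible d Q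
  step : ∀ {Q} (x1 x2 : V Q) → x1 ≢ x2 →
         RedDegreeAtMost d (contract Q x1 x2) →
         Reducible d (contract Q x1 x2) → Reducible d Q

initial : FinPoset → RedPoset
initial P = record { V = Fin (size P) ; _≤R_ = _≤P_ P ; red = λ _ _ → ⊥ }

NaturalTwinWidthAtMost : FinPoset → ℕ → Set₁
NaturalTwinWidthAtMost P d =
  RedDegreeAtMost d (initial P) × Reducible d (initial P)

-- Take the grid [d] × [d+1] with the product order.  Its columns are chains
-- covering it, so its width is d, attained by a diagonal antichain.  Already
-- the first contraction of two distinct cells x₁, x₂ creates d − 1 red edges:
-- every cell that is comparable with x₁ or x₂ but is neither below both nor
-- above both becomes a red neighbour of the new vertex.  If x₁, x₂ lie in
-- different columns, every row avoiding them contains such a cell (in the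
-- column of x₁ or of x₂, depending on the row); if they lie in the same column,
-- every other column does.

module Submission where

open import Defs
open import Data.Nat as ℕ using (ℕ; _≤_; _∸_; zero; suc; _*_; s≤s)
import Data.Nat.Properties as ℕₚ
open import Data.Fin as Fin using (Fin; zero; suc; opposite; punchIn; punchOut; remQuot; combine)
import Data.Fin.Properties as Finₚ
open import Data.Product using (Σ; _×_; _,_; proj₁; proj₂; uncurry; swap)
import Data.Product as Product
open import Data.Product.Relation.Binary.Pointwise.NonDependent
  using (Pointwise; ×-isPartialOrder; ≡×≡⇒≡; ≡⇒≡×≡)
open import Data.Sum using (_⊎_; inj₁; inj₂)
import Data.Sum as Sum
open import Data.Empty using (⊥-elim)
open import Data.Maybe using (just; nothing)
open import Data.Maybe.Properties using (just-injective)
open import Data.List using (List; _∷_; length; map; allFin; lookup)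
open import Data.List.Properties using (length-map; length-tabulate)
open import Data.List.Membership.Propositional.Properties using (∈-lookup)
import Data.List.Relation.Unary.All as All
import Data.List.Relation.Unary.All.Properties as Allₚ
open import Data.List.Relation.Unary.AllPairs as AllPairs using (_∷_)
import Data.List.Relation.Unary.AllPairs.Properties as AllPairsₚ
open import Data.List.Relation.Unary.Unique.Propositional using (Unique)
import Data.List.Relation.Unary.Unique.Propositional.Properties as Uniqueₚ
open import Function using (_∘_; _on_; id)
open import Function.Definitions using (Injective)
open import Level using (0ℓ)
open import Relation.Nullary using (¬_; Dec; yes; no; contradiction)
open import Relation.Binary.Core using (Rel)
open import Relation.Binary.Definitions using (tri<; tri≈; tri>)
open import Relation.Binary.Morphism.Structures using (IsOrderMonomorphism)
import Relation.Binary.Morphism.OrderMonomorphism as OrderMonomorphism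
open import Relation.Binary.PropositionalEquality

Unique⇒lookup-injective : ∀ {A : Set} {xs : List A} → Unique xs → Injective _≡_ _≡_ (lookup xs)
Unique⇒lookup-injective (_ ∷ _) {zero} {zero} _ = refl
Unique⇒lookup-injective (x∉xs ∷ _) {zero} {suc j} x≡xⱼ =
  contradiction x≡xⱼ (All.lookup x∉xs (∈-lookup j))
Unique⇒lookup-injective (x∉xs ∷ _) {suc i} {zero} xᵢ≡x =
  contradiction (sym xᵢ≡x) (All.lookup x∉xs (∈-lookup i))
Unique⇒lookup-injective (_ ∷ xs!) {suc i} {suc j} xᵢ≡xⱼ =
  cong suc (Unique⇒lookup-injective xs! xᵢ≡xⱼ)

Unique⇒length≤ : ∀ {n} {xs : List (Fin n)} → Unique xs → length xs ≤ n
Unique⇒length≤ xs! = Finₚ.injective⇒≤ (Unique⇒lookup-injective xs!)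

length-map-allFin : ∀ {A : Set} n (f : Fin n → A) → length (map f (allFin n)) ≡ n
length-map-allFin n f = trans (length-map f (allFin n)) (length-tabulate id)

-- The second clause of newRed in contract: a becomes red at the new vertex.
Separates : {A : Set} → Rel A 0ℓ → A → A → A → Set
Separates _≤_ x₁ x₂ a =
  ¬ ((a ≤ x₁ × a ≤ x₂) ⊎ (x₁ ≤ a × x₂ ≤ a)) ×
  ((a ≤ x₁ ⊎ x₁ ≤ a) ⊎ (a ≤ x₂ ⊎ x₂ ≤ a))

record Separators {A : Set} (_≤_ : Rel A 0ℓ) (x₁ x₂ : A) (m : ℕ) : Set where
  field
    point           : Fin m → A
    point-injective : Injective _≡_ _≡_ point
    point≢x₁        : ∀ t → point t ≢ x₁
    point≢x₂        : ∀ t → point t ≢ x₂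
    point-separates : ∀ t → Separates _≤_ x₁ x₂ (point t)

module _ {A : Set} {_≤_ : Rel A 0ℓ} {x₁ x₂ : A} where

  Separates-sym : ∀ {a} → Separates _≤_ x₁ x₂ a → Separates _≤_ x₂ x₁ a
  Separates-sym (¬bound , comparable) =
    ¬bound ∘ Sum.map Product.swap Product.swap , Sum.swap comparable

  Separators-sym : ∀ {m} → Separators _≤_ x₁ x₂ m → Separators _≤_ x₂ x₁ m
  Separators-sym S = record
    { point           = point
    ; point-injective = point-injective
    ; point≢x₁        = point≢x₂
    ; point≢x₂        = point≢x₁
    ; point-separates = Separates-sym ∘ point-separates
    }
    where open Separators S

module _ {A B : Set} {_≤A_ : Rel A 0ℓ} {_≤B_ : Rel B 0ℓ}
         (g : A → B) (f : B → A) (g∘f : ∀ b → g (f b) ≡ b)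
         (mono : ∀ {u v} → u ≤A v → g u ≤B g v)
         (cancel : ∀ {u v} → g u ≤B g v → u ≤A v)
         {x₁ x₂ : A} where

  Separates-reflect : ∀ {a} → Separates _≤B_ (g x₁) (g x₂) (g a) → Separates _≤A_ x₁ x₂ a
  Separates-reflect (¬bound , comparable) =
    ¬bound ∘ Sum.map (Product.map mono mono) (Product.map mono mono) ,
    Sum.map (Sum.map cancel cancel) (Sum.map cancel cancel) comparable

  Separators-reflect : ∀ {m} → Separators _≤B_ (g x₁) (g x₂) m → Separators _≤A_ x₁ x₂ m
  Separators-reflect S = record
    { point           = f ∘ point
    ; point-injective = λ {s} {t} eq →
        point-injective (trans (sym (g∘f (point s))) (trans (cong g eq) (g∘f (point t))))
    ; point≢x₁        = λ t eq → point≢x₁ t (trans (sym (g∘f (point t))) (cong g eq))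
    ; point≢x₂        = λ t eq → point≢x₂ t (trans (sym (g∘f (point t))) (cong g eq))
    ; point-separates = λ t →
        Separates-reflect (subst (Separates _≤B_ (g x₁) (g x₂)) (sym (g∘f (point t)))
                                 (point-separates t))
    }
    where open Separators S

separators⇒redDegree≥ : (P : FinPoset) {x₁ x₂ : Fin (size P)} {m k : ℕ} →
  Separators (_≤P_ P) x₁ x₂ m → RedDegreeAtMost k (contract (initial P) x₁ x₂) → m ≤ k
separators⇒redDegree≥ P {x₁} {x₂} {m} {k} S redDegree≤k =
  subst (_≤ k) (length-map-allFin m neighbour)
        (redDegree≤k nothing neighbours neighbours-unique neighbours-red)
  where
  open Separators S
  neighbour : Fin m → ContrV (initial P) x₁ x₂
  neighbour t = just (point t , point≢x₁ t , point≢x₂ t)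
  neighbours : List (ContrV (initial P) x₁ x₂)
  neighbours = map neighbour (allFin m)
  neighbours-unique : Unique neighbours
  neighbours-unique =
    Uniqueₚ.map⁺ (point-injective ∘ cong proj₁ ∘ just-injective) (Uniqueₚ.allFin⁺ m)
  neighbours-red : All.All (red (contract (initial P) x₁ x₂) nothing) neighbours
  neighbours-red = Allₚ.map⁺ (Allₚ.tabulate⁺ (inj₂ ∘ point-separates))

naturalTwinWidth≥ : (P : FinPoset) {x y : Fin (size P)} {m k : ℕ} → x ≢ y →
  (∀ {x₁ x₂} → x₁ ≢ x₂ → Separators (_≤P_ P) x₁ x₂ m) →
  NaturalTwinWidthAtMost P k → m ≤ k
naturalTwinWidth≥ P x≢y separators (_ , done z all≡z) =
  ⊥-elim (x≢y (trans (all≡z _) (sym (all≡z _))))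
naturalTwinWidth≥ P x≢y separators (_ , step x₁ x₂ x₁≢x₂ redDegree≤k _) =
  separators⇒redDegree≥ P (separators x₁≢x₂) redDegree≤k

_≤ₚ_ : ∀ {a b} → Rel (Fin a × Fin b) 0ℓ
_≤ₚ_ = Pointwise Fin._≤_ Fin._≤_

sameColumn-comparable : ∀ {a b} {p q : Fin a × Fin b} → proj₁ p ≡ proj₁ q → p ≤ₚ q ⊎ q ≤ₚ p
sameColumn-comparable {p = i , r} {.i , j} refl =
  Sum.map (Finₚ.≤-refl ,_) (Finₚ.≤-refl ,_) (Finₚ.≤-total r j)

Separators-swap : ∀ {a b m} {p₁ p₂ : Fin a × Fin b} →
  Separators _≤ₚ_ (swap p₁) (swap p₂) m → Separators _≤ₚ_ p₁ p₂ m
Separators-swap = Separators-reflect swap swap (λ _ → refl) swap-mono swap-mono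
  where
  swap-mono : ∀ {a b} {p q : Fin a × Fin b} → p ≤ₚ q → swap p ≤ₚ swap q
  swap-mono {p = _ , _} {_ , _} = Product.swap

record Avoiding (m : ℕ) {n : ℕ} (j j′ : Fin n) : Set where
  field
    embed           : Fin m → Fin n
    embed-injective : Injective _≡_ _≡_ embed
    embed≢j         : ∀ t → embed t ≢ j
    embed≢j′        : ∀ t → embed t ≢ j′

avoiding₁ : ∀ {m} (i : Fin (suc m)) → Avoiding m i i
avoiding₁ i = record
  { embed           = punchIn i
  ; embed-injective = Finₚ.punchIn-injective i _ _
  ; embed≢j         = Finₚ.punchInᵢ≢i i
  ; embed≢j′        = Finₚ.punchInᵢ≢i i
  }

avoiding₂ : ∀ {m} (j j′ : Fin (suc (suc m))) → Avoiding m j j′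
avoiding₂ j j′ with j Finₚ.≟ j′
... | yes refl = record
  { embed           = punchIn j ∘ embed
  ; embed-injective = embed-injective ∘ Finₚ.punchIn-injective j _ _
  ; embed≢j         = Finₚ.punchInᵢ≢i j ∘ embed
  ; embed≢j′        = Finₚ.punchInᵢ≢i j ∘ embed
  }
  where open Avoiding (avoiding₁ zero)
... | no j≢j′ = record
  { embed           = punchIn j ∘ embed
  ; embed-injective = embed-injective ∘ Finₚ.punchIn-injective j _ _
  ; embed≢j         = Finₚ.punchInᵢ≢i j ∘ embed
  ; embed≢j′        = λ t eq → embed≢j t
      (Finₚ.punchIn-injective j _ _ (trans eq (sym (Finₚ.punchIn-punchOut j≢j′))))
  }
  where open Avoiding (avoiding₁ (punchOut j≢j′))

module _ {a b : ℕ} {i i′ : Fin a} {j j′ : Fin b} (i<i′ : i Fin.< i′) where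

  crossing : Fin b → Fin a × Fin b
  crossing r = column (r Finₚ.<? j′) , r
    where
    column : Dec (r Fin.< j′) → Fin a
    column (yes _) = i′
    column (no _)  = i

  crossing-separates : ∀ {r} → r ≢ j′ → Separates _≤ₚ_ (i , j) (i′ , j′) (crossing r)
  crossing-separates {r} r≢j′ with r Finₚ.<? j′
  ... | yes r<j′ = ¬bound , inj₂ (inj₁ (Finₚ.≤-refl , ℕₚ.<⇒≤ r<j′))
    where
    ¬bound : ¬ (((i′ , r) ≤ₚ (i , j) × (i′ , r) ≤ₚ (i′ , j′)) ⊎
                ((i , j) ≤ₚ (i′ , r) × (i′ , j′) ≤ₚ (i′ , r)))
    ¬bound (inj₁ ((i′≤i , _) , _))  = ℕₚ.<⇒≱ i<i′ i′≤i
    ¬bound (inj₂ (_ , (_ , j′≤r))) = ℕₚ.<⇒≱ r<j′ j′≤r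
  ... | no r≮j′ = ¬bound , inj₁ (sameColumn-comparable refl)
    where
    ¬bound : ¬ (((i , r) ≤ₚ (i , j) × (i , r) ≤ₚ (i′ , j′)) ⊎
                ((i , j) ≤ₚ (i , r) × (i′ , j′) ≤ₚ (i , r)))
    ¬bound (inj₁ (_ , (_ , r≤j′))) = r≮j′ (Finₚ.≤∧≢⇒< r≤j′ r≢j′)
    ¬bound (inj₂ (_ , (i′≤i , _))) = ℕₚ.<⇒≱ i<i′ i′≤i

  crossing-separators : ∀ {m} → Avoiding m j j′ → Separators _≤ₚ_ (i , j) (i′ , j′) m
  crossing-separators A = record
    { point           = crossing ∘ embed
    ; point-injective = embed-injective ∘ cong proj₂
    ; point≢x₁        = λ t → embed≢j t ∘ cong proj₂
    ; point≢x₂        = λ t → embed≢j′ t ∘ cong proj₂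
    ; point-separates = crossing-separates ∘ embed≢j′
    }
    where open Avoiding A

Cell : ℕ → Set
Cell d = Fin d × Fin (suc d)

cell-separators : ∀ {m} {p₁ p₂ : Cell (suc m)} → p₁ ≢ p₂ → Separators _≤ₚ_ p₁ p₂ m
cell-separators {p₁ = i , j} {i′ , j′} p₁≢p₂ with Finₚ.<-cmp i i′
... | tri< i<i′ _ _ = crossing-separators i<i′ (avoiding₂ j j′)
... | tri> _ _ i′<i = Separators-sym (crossing-separators i′<i (avoiding₂ j′ j))
... | tri≈ _ refl _ with Finₚ.<-cmp j j′
...   | tri< j<j′ _ _ = Separators-swap (crossing-separators j<j′ (avoiding₁ i))
...   | tri> _ _ j′<j = Separators-sym (Separators-swap (crossing-separators j′<j (avoiding₁ i)))
...   | tri≈ _ refl _ = ⊥-elim (p₁≢p₂ refl)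

cell : ∀ d → Fin (d * suc d) → Cell d
cell d = remQuot (suc d)

index : ∀ {d} → Cell d → Fin (d * suc d)
index = uncurry combine

cell∘index : ∀ {d} (p : Cell d) → cell d (index p) ≡ p
cell∘index (i , j) = Finₚ.remQuot-combine i j

cell-injective : ∀ d → Injective _≡_ _≡_ (cell d)
cell-injective d {x} {y} eq =
  trans (sym (Finₚ.combine-remQuot {d} (suc d) x))
        (trans (cong index eq) (Finₚ.combine-remQuot {d} (suc d) y))

cell-isOrderMonomorphism : ∀ d →
  IsOrderMonomorphism _≡_ (Pointwise _≡_ _≡_) (_≤ₚ_ on cell d) _≤ₚ_ (cell d)
cell-isOrderMonomorphism d = record
  { isOrderHomomorphism = record { cong = ≡⇒≡×≡ ∘ cong (cell d) ; mono = id }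
  ; injective           = cell-injective d ∘ ≡×≡⇒≡
  ; cancel              = id
  }

grid : ℕ → FinPoset
grid d = record
  { size  = d * suc d
  ; _≤P_  = _≤ₚ_ on cell d
  ; isPO  = OrderMonomorphism.isPartialOrder (cell-isOrderMonomorphism d)
              (×-isPartialOrder Finₚ.≤-isPartialOrder Finₚ.≤-isPartialOrder)
  }

grid-separators : ∀ {m} {x₁ x₂ : Fin (size (grid (suc m)))} →
  x₁ ≢ x₂ → Separators (_≤P_ (grid (suc m))) x₁ x₂ m
grid-separators {m} x₁≢x₂ =
  Separators-reflect (cell (suc m)) index cell∘index id id
    (cell-separators (x₁≢x₂ ∘ cell-injective (suc m)))

opposite-<-antitone : ∀ {n} {i j : Fin n} → i Fin.< j → opposite j Fin.< opposite i
opposite-<-antitone {n} {i} {j} i<j =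
  subst₂ ℕ._<_ (sym (Finₚ.opposite-prop j)) (sym (Finₚ.opposite-prop i))
         (ℕₚ.∸-monoʳ-< (s≤s i<j) (Finₚ.toℕ<n j))

diagonal : ∀ {d} → Fin d → Cell d
diagonal c = c , opposite (suc c)

diagonal-≤ₚ⇒≡ : ∀ {d} {c c′ : Fin d} → diagonal c ≤ₚ diagonal c′ → c ≡ c′
diagonal-≤ₚ⇒≡ (c≤c′ , opp≤opp) =
  Finₚ.≤-antisym c≤c′ (ℕₚ.≮⇒≥ λ c<c′ → ℕₚ.<⇒≱ (opposite-<-antitone (s≤s c<c′)) opp≤opp)

grid-antichain : ∀ d → IsAntichain (grid d) (map (index ∘ diagonal) (allFin d))
grid-antichain d = AllPairsₚ.map⁺ (AllPairs.map incomparable (Uniqueₚ.allFin⁺ d))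
  where
  diagonal-≤ : ∀ {c c′} → _≤P_ (grid d) (index (diagonal c)) (index (diagonal c′)) → c ≡ c′
  diagonal-≤ = diagonal-≤ₚ⇒≡ ∘ subst₂ _≤ₚ_ (cell∘index _) (cell∘index _)
  incomparable : ∀ {c c′} → c ≢ c′ →
    ¬ Comparable (grid d) (index (diagonal c)) (index (diagonal c′))
  incomparable c≢c′ = Sum.[ c≢c′ ∘ diagonal-≤ , c≢c′ ∘ sym ∘ diagonal-≤ ]

grid-antichain-length≤ : ∀ d xs → IsAntichain (grid d) xs → length xs ≤ d
grid-antichain-length≤ d xs antichain =
  subst (_≤ d) (length-map column xs)
        (Unique⇒length≤ (AllPairsₚ.map⁺ (AllPairs.map distinctColumns antichain)))
  where
  column : Fin (size (grid d)) → Fin d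
  column = proj₁ ∘ cell d
  distinctColumns : ∀ {x y} → ¬ Comparable (grid d) x y → column x ≢ column y
  distinctColumns incomparable = incomparable ∘ sameColumn-comparable

grid-width : ∀ d → HasWidth (grid d) d
grid-width d =
  (_ , grid-antichain d , length-map-allFin d (index ∘ diagonal)) , grid-antichain-length≤ d

proposition2 : (d : ℕ) → 1 ≤ d →
    Σ FinPoset λ P → HasWidth P d ×
      ((k : ℕ) → NaturalTwinWidthAtMost P k → d ∸ 1 ≤ k)
proposition2 (suc m) _ =
  grid (suc m) , grid-width (suc m) ,
  λ k → naturalTwinWidth≥ (grid (suc m)) {x = zero} {y = suc zero} (λ ()) grid-separators
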